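{- Let $n \geq 3$. Then $$\bigcup_{p \text{ prime}} \frac{1}{p} H_p(2,1) \subseteq \limsup_{q \rightarrow \infty} \frac{1}{q} H_q^c(n,2).$$
   Context: For a prime $p$, $\mathbb{Z}_p$ is the field with $p$ elements. For $v=(\bar a_1,\dots,\bar a_n)\in\mathbb{Z}_p^n$ with $0\le a_i<p$ the least nonnegative representatives, $h_p(v)=a_1+\dots+a_n$; for a nonzero subspace $V$, $h_p(V)=\min\{h_p(v):v\in V\setminus\{0\}\}$. $H_p(2,1)$ is the set of $h_p(V)$ over all one-dimensional subspaces $V\subseteq\mathbb{Z}_p^2$; $H_q^c(n,2)$ is the set of $h_q(V)$ over all subspaces $V\subseteq\mathbb{Z}_q^n$ of codimension $2$; $\frac1p S=\{x/p:x\in S\}$. A real $x$ belongs to $\limsup_{q\to\infty}\frac1q H_q^c(n,2)$ if there exist an infinite sequence of distinct primes $q_i$ and $x_i\in\frac1{q_i}H_{q_i}^c(n,2)$ with $x_i\to x$. -}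

module Defs where

open import Data.Nat using (ℕ; zero; suc; _+_; _*_; _≤_; NonZero)
open import Data.Nat.DivMod using (_%_)
open import Data.Nat.Primality using (Prime; prime⇒nonZero)
open import Data.Fin using (Fin; toℕ)
import Data.Fin as Fin
open import Data.Integer using (+_)
open import Data.Rational using (ℚ; _/_; _-_; ∣_∣; _<_; 0ℚ)
open import Data.Product using (Σ; ∃; _×_)
open import Relation.Binary.PropositionalEquality using (_≡_; _≢_)

sumFin : ∀ {d} → (Fin d → ℕ) → ℕ
sumFin {zero}  f = 0
sumFin {suc d} f = f Fin.zero + sumFin (λ j → f (Fin.suc j))

-- An element of ℤ_p is represented by its least nonnegative representative,
-- i.e. an element of Fin p.  A vector of ℤ_p^n is  Fin n → Fin p.
Vec𝔽 : ℕ → ℕ → Set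
Vec𝔽 p n = Fin n → Fin p

-- A d-dimensional subspace of ℤ_p^n is given by a basis B : Fin d → ℤ_p^n.
-- lincomb c B is the vector  Σ_j c_j B_j  (componentwise, reduced mod p,
-- so components are least nonnegative representatives).
lincomb : ∀ {p n d} → Prime p → (Fin d → Fin p) → (Fin d → Vec𝔽 p n) → Fin n → ℕ
lincomb {p} pp c B i =
  _%_ (sumFin (λ j → toℕ (c j) * toℕ (B j i))) p {{prime⇒nonZero pp}}

-- h_p of a vector given by its least nonnegative representatives.
weight : ∀ {n} → (Fin n → ℕ) → ℕ
weight v = sumFin v

NonZeroCoeffs : ∀ {p d} → (Fin d → Fin p) → Set
NonZeroCoeffs c = ∃ λ j → toℕ (c j) ≢ 0

LinIndep : ∀ {p n d} → Prime p → (Fin d → Vec𝔽 p n) → Set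
LinIndep {p} {n} {d} pp B =
  (c : Fin d → Fin p) → (∀ i → lincomb pp c B i ≡ 0) → ∀ j → toℕ (c j) ≡ 0

-- h_p(V) = m  for V = span B: m is the minimum of h_p over nonzero vectors
-- of V (nonzero vectors of V are exactly lincomb c B with c ≠ 0, B independent).
HasMinWeight : ∀ {p n d} → Prime p → (Fin d → Vec𝔽 p n) → ℕ → Set
HasMinWeight {p} {n} {d} pp B m =
  (Σ (Fin d → Fin p) λ c → NonZeroCoeffs c × weight (lincomb pp c B) ≡ m)
  × ((c : Fin d → Fin p) → NonZeroCoeffs c → m ≤ weight (lincomb pp c B))

-- m ∈ { h_p(V) : V ⊆ ℤ_p^n a subspace of dimension d }.
InH : (p : ℕ) → Prime p → (n d : ℕ) → ℕ → Set
InH p pp n d m =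
  Σ (Fin d → Vec𝔽 p n) λ B → LinIndep pp B × HasMinWeight pp B m

InH-dim : (p : ℕ) → Prime p → (n k : ℕ) → ℕ → Set
InH-dim p pp n k m = InH p pp n k m

InH-codim : (q : ℕ) → Prime q → (n k : ℕ) → ℕ → Set
InH-codim q qq n k m = InH q qq n (n Data.Nat.∸ k) m

frac : (m p : ℕ) → Prime p → ℚ
frac m p pp = _/_ (+ m) p {{prime⇒nonZero pp}}

ConvergesTo : (ℕ → ℚ) → ℚ → Set
ConvergesTo s x =
  (ε : ℚ) → 0ℚ < ε → ∃ λ N → (i : ℕ) → N ≤ i → ∣ s i - x ∣ < ε

-- x ∈ limsup_{q→∞} (1/q) H_q^c(n,k): there is a sequence of pairwise distinct
-- primes q_i and x_i = m_i / q_i with m_i ∈ H_{q_i}^c(n,k) and x_i → x.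
InLimsupHc : (n k : ℕ) → ℚ → Set
InLimsupHc n k x =
  Σ (ℕ → ℕ) λ q → Σ ((i : ℕ) → Prime (q i)) λ qp →
  ((i j : ℕ) → q i ≡ q j → i ≡ j) ×
  Σ (ℕ → ℕ) λ m → ((i : ℕ) → InH-codim (q i) (qp i) n k (m i)) ×
  ConvergesTo (λ i → frac (m i) (q i) (qp i)) x

module Submission where

-- Let (a, b) be a minimal-weight vector of the line of ℤ_p² realising m, so
-- m = a + b ≤ p and every nonzero multiple N·(a, b) has weight ≥ m.  For a
-- prime q > p, the n − 2 vectors  v_j = (a, b, (q − p) e_j)  span a subspace
-- V ⊆ ℤ_q^n of codimension 2.  A nonzero combination with coefficient total S
-- has weight  (S a mod q) + (S b mod q) + R  with  R ≡ −S p (mod q);  the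
-- multiples of q  p·(S a mod q) + a R  and  p·(S b mod q) + b R  reduce
-- modulo p to a point of the line, giving  m q ≤ p · weight,  while ⌊q/p⌋·v_0
-- has  p · weight ≤ m q + p².  So h = h_q(V) (found by exhaustive search)
-- satisfies |h/q − m/p| ≤ p/q; q then runs through increasing primes.

open import Defs
open import Data.Nat using (ℕ; zero; suc; pred; _+_; _*_; _∸_; _≤_; _<_; _≤?_; _<?_; _≟_; _!;
  NonZero; z≤n; s≤s; >-nonZero⁻¹; ≢-nonZero⁻¹; nonTrivial⇒n>1; nonTrivial⇒≢1)
open import Data.Nat.Properties
open import Data.Nat.DivMod
open import Data.Nat.Divisibility using (_∣_; divides; ∣-trans; ∣⇒≤; ∣m+n∣m⇒∣n; m∣m*n; ∣1⇒≡1;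
  m≤n⇒m!∣n!; m%n≡0⇒n∣m; n∣m⇒m%n≡0)
open import Data.Nat.Primality using (Prime; prime⇒nonZero; prime⇒nonTrivial; euclidsLemma)
open import Data.Nat.Primality.Factorisation using (factorise; module PrimeFactorisation)
open import Data.Nat.ListAction using (product)
open import Data.Nat.Tactic.RingSolver using (solve-∀)
open import Data.Fin as Fin using (Fin; zero; suc; toℕ; fromℕ<)
open import Data.Fin.Properties using (toℕ-fromℕ<; toℕ<n; any?)
import Data.Fin.Properties as Finₚ
open import Data.Vec.Functional using (Vector; head; tail) renaming (_∷_ to _∷ᵥ_)
open import Data.Integer as ℤ using (+[1+_]; -[1+_])
import Data.Integer.Properties as ℤP
import Data.Integer.Tactic.RingSolver as ℤ-Ring
open import Data.Rational as ℚ using (ℚ; mkℚ; toℚᵘ; 0ℚ)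
import Data.Rational.Properties as ℚP
open import Data.Rational.Unnormalised as ℚᵘ using (mkℚᵘ; *<*)
import Data.Rational.Unnormalised.Properties as ℚᵘP
open import Data.List using ([]; _∷_)
open import Data.List.Relation.Unary.All using (All; _∷_)
open import Data.Product using (Σ; ∃; _×_; _,_; proj₁; proj₂)
open import Data.Sum using (inj₁; inj₂)
open import Data.Empty using (⊥-elim)
open import Function using (_∘_)
open import Level using (0ℓ)
open import Relation.Nullary using (¬_; Dec; yes; no; _×-dec_)
open import Relation.Nullary.Decidable using (¬?)
open import Relation.Unary using (Pred; Decidable)
open import Relation.Binary.Definitions using (_Respects_; tri<; tri≈; tri>)
open import Relation.Binary.PropositionalEquality

IsMinimum : {A : Set} → Pred A 0ℓ → (A → ℕ) → ℕ → Set
IsMinimum {A} P f m = (Σ A λ a → P a × f a ≡ m) × (∀ a → P a → m ≤ f a)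

least : (Q : Pred ℕ 0ℓ) → Decidable Q → ∀ K → Q K →
        Σ ℕ λ k → Q k × (∀ j → Q j → k ≤ j)
least Q Q? K qK with Q? 0
... | yes q0 = 0 , q0 , λ _ _ → z≤n
least Q Q? zero    qK | no ¬q0 = ⊥-elim (¬q0 qK)
least Q Q? (suc K) qK | no ¬q0 with least (Q ∘ suc) (Q? ∘ suc) K qK
... | k , qk , below = suc k , qk , λ where
  zero    q0 → ⊥-elim (¬q0 q0)
  (suc j) qj → s≤s (below j qj)

anyVector? : ∀ k {q} {P : Pred (Vector (Fin q) k) 0ℓ} →
             P Respects _≗_ → Decidable P → Dec (∃ P)
anyVector? zero resp P? with P? (λ ())
... | yes p = yes (_ , p)
... | no ¬p = no λ (c , pc) → ¬p (resp (λ ()) pc)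
anyVector? (suc k) {P = P} resp P?
  with any? (λ x → anyVector? k (λ eq → resp (consCong x eq)) (P? ∘ (x ∷ᵥ_)))
  where
  consCong : ∀ x {c c′} → c ≗ c′ → (x ∷ᵥ c) ≗ (x ∷ᵥ c′)
  consCong x eq zero    = refl
  consCong x eq (suc j) = eq j
... | yes (x , c , p) = yes (x ∷ᵥ c , p)
... | no none = no λ (c , pc) → none (head c , tail c , resp (sym ∘ η c) pc)
  where
  η : ∀ c → (head c ∷ᵥ tail c) ≗ c
  η c zero    = refl
  η c (suc j) = refl

-- Every ℕ-valued function attains a minimum on a nonempty decidable set of
-- coefficient vectors: apply the least number principle to "f ≤ j is attained".
minimum : ∀ k {q} (P : Pred (Vector (Fin q) k) 0ℓ) (f : Vector (Fin q) k → ℕ) →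
          P Respects _≗_ → (∀ {c c′} → c ≗ c′ → f c ≡ f c′) → Decidable P →
          ∃ P → ∃ (IsMinimum P f)
minimum k P f respP respf P? (c₀ , pc₀)
  with least Q Q? (f c₀) (c₀ , pc₀ , ≤-refl)
  where
  Q : Pred ℕ 0ℓ
  Q j = ∃ λ c → P c × f c ≤ j
  Q? : Decidable Q
  Q? j = anyVector? k (λ c≗c′ (pc , fc≤j) → respP c≗c′ pc , subst (_≤ j) (respf c≗c′) fc≤j)
                      (λ c → P? c ×-dec f c ≤? j)
... | j , (c , pc , fc≤j) , below =
  j , (c , pc , ≤-antisym fc≤j (below (f c) (c , pc , ≤-refl))) ,
  λ c′ pc′ → below (f c′) (c′ , pc′ , ≤-refl)

module _ (d : ℕ) .{{_ : NonZero d}} where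

  %-absorbʳ-+ : ∀ x y → (x + y % d) % d ≡ (x + y) % d
  %-absorbʳ-+ x y = begin
    (x + y % d) % d              ≡⟨ %-distribˡ-+ x (y % d) d ⟩
    (x % d + y % d % d) % d      ≡⟨ cong (λ z → (x % d + z) % d) (m%n%n≡m%n y d) ⟩
    (x % d + y % d) % d          ≡⟨ %-distribˡ-+ x y d ⟨
    (x + y) % d                  ∎
    where open ≡-Reasoning

  %-absorbˡ-+ : ∀ x y → (x % d + y) % d ≡ (x + y) % d
  %-absorbˡ-+ x y = begin
    (x % d + y) % d              ≡⟨ %-distribˡ-+ (x % d) y d ⟩
    (x % d % d + y % d) % d      ≡⟨ cong (λ z → (z + y % d) % d) (m%n%n≡m%n x d) ⟩
    (x % d + y % d) % d          ≡⟨ %-distribˡ-+ x y d ⟨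
    (x + y) % d                  ∎
    where open ≡-Reasoning

  %-absorbˡ-* : ∀ x y → ((x % d) * y) % d ≡ (x * y) % d
  %-absorbˡ-* x y = begin
    ((x % d) * y) % d            ≡⟨ %-distribˡ-* (x % d) y d ⟩
    ((x % d % d) * (y % d)) % d  ≡⟨ cong (λ z → (z * (y % d)) % d) (m%n%n≡m%n x d) ⟩
    ((x % d) * (y % d)) % d      ≡⟨ %-distribˡ-* x y d ⟨
    (x * y) % d                  ∎
    where open ≡-Reasoning

  %-rescale : ∀ x y z → ((x * y) % d * z) % d ≡ ((y * z) % d * x) % d
  %-rescale x y z = begin
    ((x * y) % d * z) % d   ≡⟨ %-absorbˡ-* (x * y) z ⟩
    (x * y * z) % d         ≡⟨ cong (_% d) (rotate x y z) ⟩
    (y * z * x) % d         ≡⟨ %-absorbˡ-* (y * z) x ⟨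
    ((y * z) % d * x) % d   ∎
    where
    open ≡-Reasoning
    rotate : ∀ x y z → x * y * z ≡ y * z * x
    rotate = solve-∀

  %≡0-*ˡ : ∀ a N → N % d ≡ 0 → (a * N) % d ≡ 0
  %≡0-*ˡ a N N≡0 = n∣m⇒m%n≡0 (a * N) d (divides-* (m%n≡0⇒n∣m N d N≡0))
    where
    divides-* : d ∣ N → d ∣ a * N
    divides-* (divides k refl) = divides (a * k) (sym (*-assoc a k d))

  %≡0⇒≥ : ∀ x → x % d ≡ 0 → x ≢ 0 → d ≤ x
  %≡0⇒≥ zero    _  x≢0 = ⊥-elim (x≢0 refl)
  %≡0⇒≥ (suc x) x≡0 _  = ∣⇒≤ (m%n≡0⇒n∣m (suc x) d x≡0)

  %≡0⇒+≤ : ∀ x y → x < d → y < d → (x + y) % d ≡ 0 → x + y ≤ d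
  %≡0⇒+≤ x y x<d y<d e with m%n≡0⇒n∣m (x + y) d e
  ... | divides zero          x+y≡0  = ≤-trans (≤-reflexive x+y≡0) z≤n
  ... | divides (suc zero)    x+y≡d  = ≤-reflexive (trans x+y≡d (+-identityʳ d))
  ... | divides (suc (suc k)) x+y≡kd =
    ⊥-elim (<⇒≱ (+-mono-< x<d y<d) (≤-trans (m≤m+n (d + d) (k * d))
                                          (≤-reflexive (trans (+-assoc d d (k * d)) (sym x+y≡kd)))))

  <⇒%≢0 : ∀ x → x < d → x ≢ 0 → x % d ≢ 0
  <⇒%≢0 x x<d x≢0 e = x≢0 (trans (sym (m<n⇒m%n≡m x<d)) e)

-- Lifting a coordinate from ℤ_q back to the line over ℤ_p.  If R + S p = N q,
-- then  p·(S x mod q) + x R  is a multiple ρ q of q whose quotient satisfies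
-- ρ ≡ x N (mod p).
liftCoordinate : ∀ p q .{{_ : NonZero p}} .{{_ : NonZero q}} x S R N →
                 R + S * p ≡ N * q →
                 Σ ℕ λ ρ → p * ((S * x) % q) + x * R ≡ ρ * q × ρ % p ≡ (x * N) % p
liftCoordinate p q x S R N R+Sp≡Nq = ρ , ρq≡ , ρ≡xN
  where
  X g : ℕ
  X = (S * x) % q
  g = (S * x) / q

  total : g * p * q + (p * X + x * R) ≡ x * N * q
  total = begin
    g * p * q + (p * X + x * R)  ≡⟨ regroup g p q X x R ⟩
    p * (X + g * q) + x * R      ≡⟨ cong (λ z → p * z + x * R) (m≡m%n+[m/n]*n (S * x) q) ⟨
    p * (S * x) + x * R          ≡⟨ factor p S x R ⟩
    x * (R + S * p)              ≡⟨ cong (x *_) R+Sp≡Nq ⟩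
    x * (N * q)                  ≡⟨ *-assoc x N q ⟨
    x * N * q                    ∎
    where
    open ≡-Reasoning
    regroup : ∀ g p q X x R → g * p * q + (p * X + x * R) ≡ p * (X + g * q) + x * R
    regroup = solve-∀
    factor : ∀ p S x R → p * (S * x) + x * R ≡ x * (R + S * p)
    factor = solve-∀

  q∣ : q ∣ p * X + x * R
  q∣ = ∣m+n∣m⇒∣n (divides (x * N) total) (divides (g * p) refl)

  ρ : ℕ
  ρ = _∣_.quotient q∣
  ρq≡ : p * X + x * R ≡ ρ * q
  ρq≡ = _∣_.equality q∣

  ρ+gp≡xN : ρ + g * p ≡ x * N
  ρ+gp≡xN = *-cancelʳ-≡ (ρ + g * p) (x * N) q (begin
    (ρ + g * p) * q            ≡⟨ *-distribʳ-+ q ρ (g * p) ⟩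
    ρ * q + g * p * q          ≡⟨ cong (_+ g * p * q) ρq≡ ⟨
    p * X + x * R + g * p * q  ≡⟨ +-comm (p * X + x * R) (g * p * q) ⟩
    g * p * q + (p * X + x * R) ≡⟨ total ⟩
    x * N * q                  ∎)
    where open ≡-Reasoning

  ρ≡xN : ρ % p ≡ (x * N) % p
  ρ≡xN = trans (sym ([m+kn]%n≡m%n ρ g p)) (cong (_% p) ρ+gp≡xN)

module _ {p : ℕ} (pp : Prime p) where
  private instance
    p≢0 : NonZero p
    p≢0 = prime⇒nonZero pp

  %≢0-* : ∀ x y → x % p ≢ 0 → y % p ≢ 0 → (x * y) % p ≢ 0
  %≢0-* x y x≢0 y≢0 xy≡0 with euclidsLemma x y pp (m%n≡0⇒n∣m (x * y) p xy≡0)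
  ... | inj₁ p∣x = x≢0 (n∣m⇒m%n≡0 x p p∣x)
  ... | inj₂ p∣y = y≢0 (n∣m⇒m%n≡0 y p p∣y)

-- Lines of ℤ_p².  The points of the line spanned by (a, b) are the multiples
-- N·(a, b), whose h_p-weight is  (a N mod p) + (b N mod p).
module Line {p : ℕ} (pp : Prime p) where
  private instance
    p≢0 : NonZero p
    p≢0 = prime⇒nonZero pp

  record MinimalGenerator (m : ℕ) : Set where
    field
      a b     : ℕ
      a<p     : a < p
      b<p     : b < p
      m≡a+b   : m ≡ a + b
      nonzero : ¬ (a ≡ 0 × b ≡ 0)
      minimal : ∀ N → N % p ≢ 0 → m ≤ (a * N) % p + (b * N) % p

  -- Every element of H_p(2,1) is the weight of a minimal generator of a line:
  -- namely of the minimal-weight vector itself.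
  minimalGenerator : ∀ {m} → InH p pp 2 1 m → MinimalGenerator m
  minimalGenerator {m} (B , indep , (c , (zero , c≢0) , wc≡m) , lower) = record
    { a = a ; b = b ; a<p = m%n<n (t * A) p ; b<p = m%n<n (t * A′) p
    ; m≡a+b = trans (sym wc≡m) (lineWeight c)
    ; nonzero = λ (a≡0 , b≡0) → c≢0 (indep c (λ where
        zero       → trans (cong (_% p) (+-identityʳ (t * A))) a≡0
        (suc zero) → trans (cong (_% p) (+-identityʳ (t * A′))) b≡0) zero)
    ; minimal = minimal }
    where
    t A A′ a b : ℕ
    t  = toℕ (c zero)
    A  = toℕ (B zero zero)
    A′ = toℕ (B zero (suc zero))
    a  = (t * A) % p
    b  = (t * A′) % p

    lineWeight : ∀ s → weight (lincomb pp s B) ≡ (toℕ (s zero) * A) % p + (toℕ (s zero) * A′) % p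
    lineWeight s = cong₂ _+_ (cong (_% p) (+-identityʳ _))
                             (trans (+-identityʳ _) (cong (_% p) (+-identityʳ _)))

    minimal : ∀ N → N % p ≢ 0 → m ≤ (a * N) % p + (b * N) % p
    minimal N N≢0 = subst (m ≤_) weight≡ (lower s (zero , s≢0))
      where
      Nt<p : (N * t) % p < p
      Nt<p = m%n<n (N * t) p
      s : Fin 1 → Fin p
      s _ = fromℕ< Nt<p
      s≢0 : toℕ (s zero) ≢ 0
      s≢0 e = %≢0-* pp N t N≢0 (<⇒%≢0 p t (toℕ<n (c zero)) c≢0)
                (trans (sym (toℕ-fromℕ< Nt<p)) e)
      weight≡ : weight (lincomb pp s B) ≡ (a * N) % p + (b * N) % p
      weight≡ = begin
        weight (lincomb pp s B)
          ≡⟨ lineWeight s ⟩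
        (toℕ (s zero) * A) % p + (toℕ (s zero) * A′) % p
          ≡⟨ cong (λ z → (z * A) % p + (z * A′) % p) (toℕ-fromℕ< Nt<p) ⟩
        ((N * t) % p * A) % p + ((N * t) % p * A′) % p
          ≡⟨ cong₂ _+_ (%-rescale p N t A) (%-rescale p N t A′) ⟩
        (a * N) % p + (b * N) % p
          ∎
        where open ≡-Reasoning

  module _ {m : ℕ} (g : MinimalGenerator m) where
    open MinimalGenerator g

    -- A minimal weight on a line is at most p: the coordinates of a point and
    -- of its negative −(a, b) = (p − 1)·(a, b) pairwise sum to 0 or p.
    weight≤p : m ≤ p
    weight≤p = *-cancelˡ-≤ 2 (begin
      2 * m                  ≡⟨ cong (m +_) (+-identityʳ m) ⟩
      m + m                  ≤⟨ +-mono-≤ (≤-reflexive m≡a+b) (minimal (p ∸ 1) p-1≢0) ⟩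
      (a + b) + (a⁻ + b⁻)    ≡⟨ interchange a b a⁻ b⁻ ⟩
      (a + a⁻) + (b + b⁻)    ≤⟨ +-mono-≤ (complement a a<p) (complement b b<p) ⟩
      p + p                  ≡⟨ cong (p +_) (+-identityʳ p) ⟨
      2 * p                  ∎)
      where
      open ≤-Reasoning
      a⁻ b⁻ : ℕ
      a⁻ = (a * (p ∸ 1)) % p
      b⁻ = (b * (p ∸ 1)) % p
      1<p : 1 < p
      1<p = nonTrivial⇒n>1 p {{prime⇒nonTrivial pp}}
      p-1≢0 : (p ∸ 1) % p ≢ 0
      p-1≢0 = <⇒%≢0 p (p ∸ 1) (∸-monoʳ-< {p} {1} {0} (s≤s z≤n) (<⇒≤ 1<p)) (m<n⇒n≢0 (m<n⇒0<n∸m 1<p))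
      interchange : ∀ w x y z → (w + x) + (y + z) ≡ (w + y) + (x + z)
      interchange = solve-∀
      complement : ∀ x → x < p → x + (x * (p ∸ 1)) % p ≤ p
      complement x x<p = %≡0⇒+≤ p x _ x<p (m%n<n _ p) (begin-equality
        (x + (x * (p ∸ 1)) % p) % p  ≡⟨ %-absorbʳ-+ p x (x * (p ∸ 1)) ⟩
        (x + x * (p ∸ 1)) % p        ≡⟨ cong (λ z → (z + x * (p ∸ 1)) % p) (*-identityʳ x) ⟨
        (x * 1 + x * (p ∸ 1)) % p    ≡⟨ cong (_% p) (*-distribˡ-+ x 1 (p ∸ 1)) ⟨
        (x * (1 + (p ∸ 1))) % p      ≡⟨ cong (λ z → (x * z) % p) (m+[n∸m]≡n (<⇒≤ 1<p)) ⟩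
        (x * p) % p                  ≡⟨ m*n%n≡0 x p ⟩
        0                            ∎)

    -- A pair (ρ, σ) ≠ (0, 0) reducing mod p to a point N·(a, b) of the line has
    -- ρ + σ ≥ m: either the point is nonzero (minimality), or ρ and σ are
    -- multiples of p, one of them nonzero (m ≤ p).
    liftBound : ∀ N ρ σ → ρ % p ≡ (a * N) % p → σ % p ≡ (b * N) % p →
                ¬ (ρ ≡ 0 × σ ≡ 0) → m ≤ ρ + σ
    liftBound N ρ σ ρ≡ σ≡ ρσ≢0 with N % p ≟ 0
    ... | no N≢0 = begin
      m                          ≤⟨ minimal N N≢0 ⟩
      (a * N) % p + (b * N) % p  ≡⟨ cong₂ _+_ ρ≡ σ≡ ⟨
      ρ % p + σ % p              ≤⟨ +-mono-≤ (m%n≤m ρ p) (m%n≤m σ p) ⟩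
      ρ + σ                      ∎
      where open ≤-Reasoning
    ... | yes N≡0 with ρ ≟ 0 | σ ≟ 0
    ...   | no ρ≢0 | _ = ≤-trans weight≤p
              (≤-trans (%≡0⇒≥ p ρ (trans ρ≡ (%≡0-*ˡ p a N N≡0)) ρ≢0) (m≤m+n ρ σ))
    ...   | yes _ | no σ≢0 = ≤-trans weight≤p
              (≤-trans (%≡0⇒≥ p σ (trans σ≡ (%≡0-*ˡ p b N N≡0)) σ≢0) (m≤n+m σ ρ))
    ...   | yes ρ≡0 | yes σ≡0 = ⊥-elim (ρσ≢0 (ρ≡0 , σ≡0))

    liftedWeight : ∀ q .{{_ : NonZero q}} S R → R ≢ 0 → q ∣ R + S * p →
                   m * q ≤ p * ((S * a) % q + ((S * b) % q + R))
    liftedWeight q S R R≢0 (divides N R+Sp≡Nq)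
      with liftCoordinate p q a S R N R+Sp≡Nq | liftCoordinate p q b S R N R+Sp≡Nq
    ... | ρ , ρq≡ , ρ≡aN | σ , σq≡ , σ≡bN = begin
      m * q                              ≤⟨ *-monoˡ-≤ q (liftBound N ρ σ ρ≡aN σ≡bN notBoth) ⟩
      (ρ + σ) * q                        ≡⟨ *-distribʳ-+ q ρ σ ⟩
      ρ * q + σ * q                      ≡⟨ cong₂ _+_ ρq≡ σq≡ ⟨
      (p * X + a * R) + (p * Y + b * R)  ≡⟨ regroup p X Y a b R ⟩
      p * X + p * Y + (a + b) * R        ≡⟨ cong (λ z → p * X + p * Y + z * R) m≡a+b ⟨
      p * X + p * Y + m * R              ≤⟨ +-monoʳ-≤ (p * X + p * Y) (*-monoˡ-≤ R weight≤p) ⟩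
      p * X + p * Y + p * R              ≡⟨ factor p X Y R ⟩
      p * (X + (Y + R))                  ∎
      where
      open ≤-Reasoning
      X Y : ℕ
      X = (S * a) % q
      Y = (S * b) % q
      regroup : ∀ p X Y a b R → (p * X + a * R) + (p * Y + b * R) ≡ p * X + p * Y + (a + b) * R
      regroup = solve-∀
      factor : ∀ p X Y R → p * X + p * Y + p * R ≡ p * (X + (Y + R))
      factor = solve-∀
      vanishing : ∀ x Z ρ → p * Z + x * R ≡ ρ * q → ρ ≡ 0 → x ≡ 0
      vanishing x Z ρ e refl with m*n≡0⇒m≡0∨n≡0 x (m+n≡0⇒n≡0 (p * Z) e)
      ... | inj₁ x≡0 = x≡0
      ... | inj₂ R≡0 = ⊥-elim (R≢0 R≡0)
      notBoth : ¬ (ρ ≡ 0 × σ ≡ 0)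
      notBoth (ρ≡0 , σ≡0) = nonzero (vanishing a X ρ ρq≡ ρ≡0 , vanishing b Y σ σq≡ σ≡0)

sumFin-cong : ∀ {k} {f g : Fin k → ℕ} → f ≗ g → sumFin f ≡ sumFin g
sumFin-cong {zero}  f≗g = refl
sumFin-cong {suc k} f≗g = cong₂ _+_ (f≗g zero) (sumFin-cong (f≗g ∘ suc))

sumFin-*ʳ : ∀ {k} (f : Fin k → ℕ) x → sumFin (λ j → f j * x) ≡ sumFin f * x
sumFin-*ʳ {zero}  f x = refl
sumFin-*ʳ {suc k} f x = trans (cong (f zero * x +_) (sumFin-*ʳ (f ∘ suc) x))
                              (sym (*-distribʳ-+ x (f zero) (sumFin (f ∘ suc))))

sumFin-zero : ∀ {k} (f : Fin k → ℕ) → (∀ j → f j ≡ 0) → sumFin f ≡ 0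
sumFin-zero {zero}  f f≡0 = refl
sumFin-zero {suc k} f f≡0 = cong₂ _+_ (f≡0 zero) (sumFin-zero (f ∘ suc) (f≡0 ∘ suc))

sumFin-single : ∀ {k} (f : Fin k → ℕ) i → (∀ j → j ≢ i → f j ≡ 0) → sumFin f ≡ f i
sumFin-single f zero off =
  trans (cong (f zero +_) (sumFin-zero (f ∘ suc) (λ j → off (suc j) λ ()))) (+-identityʳ (f zero))
sumFin-single f (suc i) off =
  trans (cong (_+ sumFin (f ∘ suc)) (off zero λ ()))
        (sumFin-single (f ∘ suc) i (λ j j≢i → off (suc j) (j≢i ∘ Finₚ.suc-injective)))

term≤sumFin : ∀ {k} (f : Fin k → ℕ) i → f i ≤ sumFin f
term≤sumFin f zero    = m≤m+n (f zero) (sumFin (f ∘ suc))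
term≤sumFin f (suc i) = ≤-trans (term≤sumFin (f ∘ suc) i) (m≤n+m (sumFin (f ∘ suc)) (f zero))

sumFin-% : ∀ {k} d .{{_ : NonZero d}} (f : Fin k → ℕ) → sumFin (λ j → f j % d) % d ≡ sumFin f % d
sumFin-% {zero}  d f = refl
sumFin-% {suc k} d f = begin
  (f zero % d + sumFin (λ j → f (suc j) % d)) % d  ≡⟨ %-absorbˡ-+ d (f zero) _ ⟩
  (f zero + sumFin (λ j → f (suc j) % d)) % d      ≡⟨ %-absorbʳ-+ d (f zero) _ ⟨
  (f zero + sumFin (λ j → f (suc j) % d) % d) % d  ≡⟨ cong (λ z → (f zero + z) % d) (sumFin-% d (f ∘ suc)) ⟩
  (f zero + sumFin (f ∘ suc) % d) % d              ≡⟨ %-absorbʳ-+ d (f zero) _ ⟩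
  (f zero + sumFin (f ∘ suc)) % d                  ∎
  where open ≡-Reasoning

module Construction {p : ℕ} (pp : Prime p) {m : ℕ} (g : Line.MinimalGenerator pp m)
                    {q : ℕ} (qq : Prime q) (p<q : p < q) (d : ℕ) where
  open Line pp using (module MinimalGenerator; weight≤p; liftedWeight)
  open MinimalGenerator g

  private instance
    p≢0 : NonZero p
    p≢0 = prime⇒nonZero pp
    q≢0 : NonZero q
    q≢0 = prime⇒nonZero qq

  0<q : 0 < q
  0<q = >-nonZero⁻¹ q
  q-p<q : q ∸ p < q
  q-p<q = ∸-monoʳ-< {q} {p} {0} (>-nonZero⁻¹ p) (<⇒≤ p<q)

  unit : Fin (suc d) → Fin (suc d) → Fin q
  unit i j with i Fin.≟ j
  ... | yes _ = fromℕ< q-p<q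
  ... | no  _ = fromℕ< 0<q

  basis : Fin (suc d) → Vec𝔽 q (3 + d)
  basis j zero          = fromℕ< (<-trans a<p p<q)
  basis j (suc zero)    = fromℕ< (<-trans b<p p<q)
  basis j (suc (suc i)) = unit i j

  weightOf : Vector (Fin q) (suc d) → ℕ
  weightOf c = weight (lincomb qq c basis)

  unit-diag : ∀ i → toℕ (unit i i) ≡ q ∸ p
  unit-diag i with i Fin.≟ i
  ... | yes _  = toℕ-fromℕ< q-p<q
  ... | no i≢i = ⊥-elim (i≢i refl)

  unit-off : ∀ i j → i ≢ j → toℕ (unit i j) ≡ 0
  unit-off i j i≢j with i Fin.≟ j
  ... | yes i≡j = ⊥-elim (i≢j i≡j)
  ... | no  _   = toℕ-fromℕ< 0<q

  -- For coefficients c:  S c  is their total, and  R c  the weight of the last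
  -- d + 1 coordinates of  Σ c_j v_j.
  S R : Vector (Fin q) (suc d) → ℕ
  S c = sumFin (toℕ ∘ c)
  R c = sumFin (λ i → (toℕ (c i) * (q ∸ p)) % q)

  constantCoordinate : ∀ c {x} (x<q : x < q) →
                       sumFin (λ j → toℕ (c j) * toℕ (fromℕ< x<q)) % q ≡ (S c * x) % q
  constantCoordinate c {x} x<q =
    cong (_% q) (trans (sumFin-cong (λ j → cong (toℕ (c j) *_) (toℕ-fromℕ< x<q))) (sumFin-*ʳ (toℕ ∘ c) x))

  unitCoordinate : ∀ c i → lincomb qq c basis (suc (suc i)) ≡ (toℕ (c i) * (q ∸ p)) % q
  unitCoordinate c i =
    cong (_% q) (trans (sumFin-single _ i offDiagonal) (cong (toℕ (c i) *_) (unit-diag i)))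
    where
    offDiagonal : ∀ j → j ≢ i → toℕ (c j) * toℕ (unit i j) ≡ 0
    offDiagonal j j≢i = trans (cong (toℕ (c j) *_) (unit-off i j (j≢i ∘ sym))) (*-zeroʳ (toℕ (c j)))

  weight≡ : ∀ c → weightOf c ≡ (S c * a) % q + ((S c * b) % q + R c)
  weight≡ c = cong₂ _+_ (constantCoordinate c (<-trans a<p p<q))
                (cong₂ _+_ (constantCoordinate c (<-trans b<p p<q)) (sumFin-cong (unitCoordinate c)))

  -- q is prime and 0 < q − p < q, so  x (q − p)  is a unit mod q for 0 < x < q.
  unitTerm≢0 : ∀ x → x < q → x ≢ 0 → (x * (q ∸ p)) % q ≢ 0
  unitTerm≢0 x x<q x≢0 = %≢0-* qq x (q ∸ p) (<⇒%≢0 q x x<q x≢0)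
                           (<⇒%≢0 q (q ∸ p) q-p<q (m<n⇒n≢0 (m<n⇒0<n∸m p<q)))

  -- the last d + 1 coordinates alone already force linear independence
  independent : LinIndep qq basis
  independent c vanish j with toℕ (c j) ≟ 0
  ... | yes c≡0 = c≡0
  ... | no  c≢0 = ⊥-elim (unitTerm≢0 (toℕ (c j)) (toℕ<n (c j)) c≢0
                           (trans (sym (unitCoordinate c j)) (vanish (suc (suc j)))))

  R≢0 : ∀ c → NonZeroCoeffs c → R c ≢ 0
  R≢0 c (j , c≢0) R≡0 = unitTerm≢0 (toℕ (c j)) (toℕ<n (c j)) c≢0
    (n≤0⇒n≡0 (≤-trans (term≤sumFin (λ i → (toℕ (c i) * (q ∸ p)) % q) j) (≤-reflexive R≡0)))

  -- R c ≡ S c (q − p) ≡ − S c p  (mod q)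
  q∣R+Sp : ∀ c → q ∣ R c + S c * p
  q∣R+Sp c = m%n≡0⇒n∣m (R c + S c * p) q (begin
    (R c + S c * p) % q                      ≡⟨ %-absorbˡ-+ q (R c) (S c * p) ⟨
    (R c % q + S c * p) % q                  ≡⟨ cong (λ z → (z + S c * p) % q) R≡ ⟩
    ((S c * (q ∸ p)) % q + S c * p) % q      ≡⟨ %-absorbˡ-+ q (S c * (q ∸ p)) (S c * p) ⟩
    (S c * (q ∸ p) + S c * p) % q            ≡⟨ cong (_% q) (*-distribˡ-+ (S c) (q ∸ p) p) ⟨
    (S c * (q ∸ p + p)) % q                  ≡⟨ cong (λ z → (S c * z) % q) (m∸n+n≡m (<⇒≤ p<q)) ⟩
    (S c * q) % q                            ≡⟨ m*n%n≡0 (S c) q ⟩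
    0                                        ∎)
    where
    open ≡-Reasoning
    R≡ : R c % q ≡ (S c * (q ∸ p)) % q
    R≡ = trans (sumFin-% q (λ i → toℕ (c i) * (q ∸ p))) (cong (_% q) (sumFin-*ʳ (toℕ ∘ c) (q ∸ p)))

  lowerBound : ∀ c → NonZeroCoeffs c → m * q ≤ p * weightOf c
  lowerBound c c≢0 = subst (λ w → m * q ≤ p * w) (sym (weight≡ c))
                       (liftedWeight g q (S c) (R c) (R≢0 c c≢0) (q∣R+Sp c))

  -- The witness  K·v_0  with  K = ⌊q / p⌋  has weight at most  (m q + p²) / p.
  K r : ℕ
  K = q / p
  r = q % p

  K<q : K < q
  K<q = m/n<m q p (nonTrivial⇒n>1 p {{prime⇒nonTrivial pp}})

  witness : Vector (Fin q) (suc d)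
  witness zero    = fromℕ< K<q
  witness (suc _) = fromℕ< 0<q

  witness≢0 : NonZeroCoeffs witness
  witness≢0 = zero , λ K≡0 →
    m<n⇒n≢0 (m≥n⇒m/n>0 {q} {p} (<⇒≤ p<q)) (trans (sym (toℕ-fromℕ< K<q)) K≡0)

  S-witness : S witness ≡ K
  S-witness = trans (cong₂ _+_ (toℕ-fromℕ< K<q) (sumFin-zero (toℕ ∘ witness ∘ suc) (λ _ → toℕ-fromℕ< 0<q)))
                    (+-identityʳ K)

  -- K (q − p) = K q − K p ≡ r  (mod q), since  K p = q − r
  R-witness : R witness ≡ r
  R-witness = begin
    (toℕ (fromℕ< K<q) * (q ∸ p)) % q + sumFin (λ (_ : Fin d) → (toℕ (fromℕ< 0<q) * (q ∸ p)) % q)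
        ≡⟨ cong₂ _+_ (cong (λ z → (z * (q ∸ p)) % q) (toℕ-fromℕ< K<q))
                     (sumFin-zero {d} _ (λ _ → trans (cong (λ z → (z * (q ∸ p)) % q) (toℕ-fromℕ< 0<q))
                                                 (m<n⇒m%n≡m 0<q))) ⟩
    (K * (q ∸ p)) % q + 0               ≡⟨ +-identityʳ _ ⟩
    (K * (q ∸ p)) % q                   ≡⟨ [m+n]%n≡m%n (K * (q ∸ p)) q ⟨
    (K * (q ∸ p) + q) % q               ≡⟨ cong (λ z → (K * (q ∸ p) + z) % q) (m≡m%n+[m/n]*n q p) ⟩
    (K * (q ∸ p) + (r + K * p)) % q     ≡⟨ cong (_% q) (regroup K (q ∸ p) r p) ⟩
    (r + K * (q ∸ p + p)) % q           ≡⟨ cong (λ z → (r + K * z) % q) (m∸n+n≡m (<⇒≤ p<q)) ⟩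
    (r + K * q) % q                     ≡⟨ [m+kn]%n≡m%n r K q ⟩
    r % q                               ≡⟨ m<n⇒m%n≡m (<-trans (m%n<n q p) p<q) ⟩
    r                                   ∎
    where
    open ≡-Reasoning
    regroup : ∀ K x r p → K * x + (r + K * p) ≡ r + K * (x + p)
    regroup = solve-∀

  upperBound : p * weightOf witness ≤ m * q + p * p
  upperBound = begin
    p * weightOf witness
      ≡⟨ cong (p *_) (weight≡ witness) ⟩
    p * ((S witness * a) % q + ((S witness * b) % q + R witness))
      ≡⟨ cong₂ (λ s t → p * ((s * a) % q + ((s * b) % q + t))) S-witness R-witness ⟩
    p * ((K * a) % q + ((K * b) % q + r))
      ≤⟨ *-monoʳ-≤ p (+-mono-≤ (m%n≤m (K * a) q) (+-monoˡ-≤ r (m%n≤m (K * b) q))) ⟩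
    p * (K * a + (K * b + r))
      ≡⟨ regroup p K a b r ⟩
    (K * p) * (a + b) + p * r
      ≤⟨ +-mono-≤ (*-monoˡ-≤ (a + b) (m/n*n≤m q p)) (*-monoʳ-≤ p (<⇒≤ (m%n<n q p))) ⟩
    q * (a + b) + p * p
      ≡⟨ cong (λ z → q * z + p * p) m≡a+b ⟨
    q * m + p * p
      ≡⟨ cong (_+ p * p) (*-comm q m) ⟩
    m * q + p * p
      ∎
    where
    open ≤-Reasoning
    regroup : ∀ p K a b r → p * (K * a + (K * b + r)) ≡ (K * p) * (a + b) + p * r
    regroup = solve-∀

  minimumWeight : ∃ (IsMinimum NonZeroCoeffs weightOf)
  minimumWeight = minimum (suc d) NonZeroCoeffs weightOf respectsNonZero respectsWeight
                    (λ c → any? (λ j → ¬? (toℕ (c j) ≟ 0))) (witness , witness≢0)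
    where
    respectsNonZero : NonZeroCoeffs Respects _≗_
    respectsNonZero c≗c′ (j , c≢0) = j , λ c′≡0 → c≢0 (trans (cong toℕ (c≗c′ j)) c′≡0)
    respectsWeight : ∀ {c c′} → c ≗ c′ → weightOf c ≡ weightOf c′
    respectsWeight c≗c′ = sumFin-cong (λ i → cong (_% q)
                            (sumFin-cong (λ j → cong (λ z → toℕ z * toℕ (basis j i)) (c≗c′ j))))

  h : ℕ
  h = proj₁ minimumWeight

  h∈H : InH q qq (3 + d) (suc d) h
  h∈H = basis , independent , proj₂ minimumWeight

  h-lower : m * q ≤ p * h
  h-lower = attained (proj₂ minimumWeight)
    where
    attained : ∀ {w} → IsMinimum NonZeroCoeffs weightOf w → m * q ≤ p * w
    attained ((c , c≢0 , wc≡w) , _) = subst (λ w → m * q ≤ p * w) wc≡w (lowerBound c c≢0)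

  h-upper : p * h ≤ m * q + p * p
  h-upper = ≤-trans (*-monoʳ-≤ p (proj₂ (proj₂ minimumWeight) witness witness≢0)) upperBound

module RationalEstimate where
  open import Data.Integer using (+_)

  fracᵘ : ∀ x q (qq : Prime q) → toℚᵘ (frac x q qq) ℚᵘ.≃ mkℚᵘ (+ x) (pred q)
  fracᵘ x (suc q′) qq = ℚP.toℚᵘ-fromℚᵘ (mkℚᵘ (+ x) q′)
  fracᵘ x zero     qq = ⊥-elim (≢-nonZero⁻¹ 0 {{prime⇒nonZero qq}} refl)

  ℤ-difference : ∀ a b c d → c * d ≤ a * b →
                 + a ℤ.* + b ℤ.+ (ℤ.- (+ c)) ℤ.* + d ≡ + (a * b ∸ c * d)
  ℤ-difference a b c d cd≤ab = begin
    + a ℤ.* + b ℤ.+ (ℤ.- (+ c)) ℤ.* + d  ≡⟨ difference (+ a) (+ b) (+ c) (+ d) ⟩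
    + a ℤ.* + b ℤ.- + c ℤ.* + d          ≡⟨ cong₂ ℤ._-_ (ℤP.pos-* a b) (ℤP.pos-* c d) ⟨
    + (a * b) ℤ.- + (c * d)              ≡⟨ ℤP.m-n≡m⊖n (a * b) (c * d) ⟩
    (a * b) ℤ.⊖ (c * d)                  ≡⟨ ℤP.⊖-≥ cd≤ab ⟩
    + (a * b ∸ c * d)                    ∎
    where
    open ≡-Reasoning
    difference : ∀ a b c d → a ℤ.* b ℤ.+ (ℤ.- c) ℤ.* d ≡ a ℤ.* b ℤ.- c ℤ.* d
    difference = ℤ-Ring.solve-∀

  distance≃ : ∀ {m p h q} (pp : Prime p) (qq : Prime q) → m * q ≤ p * h →
              toℚᵘ (ℚ.∣ frac h q qq ℚ.- frac m p pp ∣)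
                ℚᵘ.≃ mkℚᵘ (+ (h * p ∸ m * q)) (pred (q * p))
  distance≃ {m} {p@(suc p′)} {h} {q@(suc q′)} pp qq mq≤ph = begin-equality
    toℚᵘ (ℚ.∣ x ℚ.- y ∣)
      ≃⟨ ℚP.toℚᵘ-homo-∣-∣ (x ℚ.- y) ⟩
    ℚᵘ.∣ toℚᵘ (x ℚ.- y) ∣
      ≃⟨ ℚᵘP.∣-∣-cong (ℚP.toℚᵘ-homo-+ x (ℚ.- y)) ⟩
    ℚᵘ.∣ toℚᵘ x ℚᵘ.+ toℚᵘ (ℚ.- y) ∣
      ≃⟨ ℚᵘP.∣-∣-cong (ℚᵘP.+-cong (fracᵘ h q qq)
                                  (ℚᵘP.≃-trans (ℚP.toℚᵘ-homo‿- y) (ℚᵘP.-‿cong (fracᵘ m p pp)))) ⟩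
    ℚᵘ.∣ mkℚᵘ (+ h) q′ ℚᵘ.- mkℚᵘ (+ m) p′ ∣
      ≡⟨ cong (λ z → mkℚᵘ (+ ℤ.∣ z ∣) (pred (q * p))) (ℤ-difference h p m q mq≤hp) ⟩
    mkℚᵘ (+ (h * p ∸ m * q)) (pred (q * p))
      ∎
    where
    open ℚᵘP.≤-Reasoning
    mq≤hp : m * q ≤ h * p
    mq≤hp = ≤-trans mq≤ph (≤-reflexive (*-comm p h))
    x y : ℚ
    x = frac h q qq
    y = frac m p pp
  distance≃ {p = zero} pp qq _ = ⊥-elim (≢-nonZero⁻¹ 0 {{prime⇒nonZero pp}} refl)
  distance≃ {p = suc _} {q = zero} pp qq _ = ⊥-elim (≢-nonZero⁻¹ 0 {{prime⇒nonZero qq}} refl)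

  -- If  m q ≤ p h ≤ m q + p²  and  q > p · (denominator of ε),  then h/q is
  -- within ε of m/p:  the distance is at most  p² / (q p) = p / q.
  approximation : ∀ {p q} (pp : Prime p) (qq : Prime q) m h (ε : ℚ) → 0ℚ ℚ.< ε →
                  m * q ≤ p * h → p * h ≤ m * q + p * p → p * ℚ.↧ₙ ε < q →
                  ℚ.∣ frac h q qq ℚ.- frac m p pp ∣ ℚ.< ε
  approximation {p@(suc _)} {q@(suc _)} pp qq m h ε@(mkℚ +[1+ a′ ] b′ _) _ lower upper q-large =
    ℚP.toℚᵘ-cancel-< (ℚᵘP.<-respˡ-≃ (ℚᵘP.≃-sym (distance≃ {m} {p} {h} {q} pp qq lower)) fraction<ε)
    where
    a b D : ℕ
    a = suc a′
    b = suc b′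
    D = h * p ∸ m * q

    D≤p² : D ≤ p * p
    D≤p² = ≤-trans (∸-monoˡ-≤ (m * q) (≤-trans (≤-reflexive (*-comm h p)) upper))
                      (≤-reflexive (m+n∸m≡n (m * q) (p * p)))

    Db<aqp : D * b < a * (q * p)
    Db<aqp = begin-strict
      D * b          ≤⟨ *-monoˡ-≤ b D≤p² ⟩
      p * p * b      ≡⟨ *-assoc p p b ⟩
      p * (p * b)    <⟨ *-monoʳ-< p q-large ⟩
      p * q          ≡⟨ *-comm p q ⟩
      q * p          ≤⟨ m≤m+n (q * p) (a′ * (q * p)) ⟩
      a * (q * p)    ∎
      where open ≤-Reasoning

    fraction<ε : mkℚᵘ (+ D) (pred (q * p)) ℚᵘ.< toℚᵘ ε
    fraction<ε = *<* (subst₂ ℤ._<_ (ℤP.pos-* D b) (ℤP.pos-* a (q * p)) (ℤ.+<+ Db<aqp))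
  approximation {suc _} {suc _} pp qq _ _ (mkℚ (+ zero) _ _) (ℚ.*<* (ℤ.+<+ ())) _ _ _
  approximation {suc _} {suc _} pp qq _ _ (mkℚ -[1+ _ ] _ _) (ℚ.*<* ()) _ _ _
  approximation {zero} pp qq _ _ _ _ _ _ _ = ⊥-elim (≢-nonZero⁻¹ 0 {{prime⇒nonZero pp}} refl)
  approximation {suc _} {zero} pp qq _ _ _ _ _ _ _ = ⊥-elim (≢-nonZero⁻¹ 0 {{prime⇒nonZero qq}} refl)

open RationalEstimate using (approximation)

-- Euclid: every n is exceeded by a prime, namely any prime factor of n! + 1.
primeAbove : ∀ n → Σ ℕ λ r → Prime r × n < r
primeAbove n = firstFactor factors isFactorisation factorsPrime
  where
  open PrimeFactorisation (factorise (suc (n !)))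

  ∣n! : ∀ {r} → NonZero r → r ≤ n → r ∣ n !
  ∣n! {suc r′} _ r≤n = ∣-trans (m∣m*n (r′ !)) (m≤n⇒m!∣n! r≤n)

  firstFactor : ∀ rs → suc (n !) ≡ product rs → All Prime rs → Σ ℕ λ r → Prime r × n < r
  firstFactor []       n!+1≡1 _ = ⊥-elim (≢-nonZero⁻¹ (n !) {{n !≢0}} (suc-injective n!+1≡1))
  firstFactor (r ∷ rs) n!+1≡r* (r-prime ∷ _) with n <? r
  ... | yes n<r = r , r-prime , n<r
  ... | no  n≮r = ⊥-elim (nonTrivial⇒≢1 {{prime⇒nonTrivial r-prime}} (∣1⇒≡1 r∣1))
    where
    r∣n!+1 : r ∣ n ! + 1
    r∣n!+1 = divides (product rs) (trans (+-comm (n !) 1) (trans n!+1≡r* (*-comm r (product rs))))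
    r∣1 : r ∣ 1
    r∣1 = ∣m+n∣m⇒∣n r∣n!+1 (∣n! (prime⇒nonZero r-prime) (≮⇒≥ n≮r))

module PrimeSequence (p : ℕ) where
  prime : ℕ → ℕ
  prime zero    = proj₁ (primeAbove p)
  prime (suc i) = proj₁ (primeAbove (prime i))

  isPrime : ∀ i → Prime (prime i)
  isPrime zero    = proj₁ (proj₂ (primeAbove p))
  isPrime (suc i) = proj₁ (proj₂ (primeAbove (prime i)))

  step : ∀ i → prime i < prime (suc i)
  step i = proj₂ (proj₂ (primeAbove (prime i)))

  above : ∀ i → p + i < prime i
  above zero    = subst (_< prime zero) (sym (+-identityʳ p)) (proj₂ (proj₂ (primeAbove p)))
  above (suc i) = subst (_< prime (suc i)) (sym (+-suc p i)) (≤-trans (s≤s (above i)) (step i))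

  increasing : ∀ {i j} → i < j → prime i < prime j
  increasing {i} {suc j} (s≤s i≤j) with m≤n⇒m<n∨m≡n i≤j
  ... | inj₁ i<j  = <-trans (increasing i<j) (step j)
  ... | inj₂ refl = step j

  injective : ∀ i j → prime i ≡ prime j → i ≡ j
  injective i j qᵢ≡qⱼ with <-cmp i j
  ... | tri< i<j _ _   = ⊥-elim (<⇒≢ (increasing i<j) qᵢ≡qⱼ)
  ... | tri≈ _ i≡j _   = i≡j
  ... | tri> _ _ j<i   = ⊥-elim (<⇒≢ (increasing j<i) (sym qᵢ≡qⱼ))

theorem7 : (n : ℕ) → 3 ≤ n →
    (p : ℕ) (pp : Prime p) (m : ℕ) → InH-dim p pp 2 1 m →
    InLimsupHc n 2 (frac m p pp)
theorem7 (suc (suc (suc d))) (s≤s (s≤s (s≤s z≤n))) p pp m m∈H =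
  prime , isPrime , injective , Cᵢ.h , Cᵢ.h∈H , converges
  where
  open PrimeSequence p

  p<prime : ∀ i → p < prime i
  p<prime i = ≤-<-trans (m≤m+n p i) (above i)

  module Cᵢ (i : ℕ) = Construction pp (Line.minimalGenerator pp m∈H) (isPrime i) (p<prime i) d

  -- |hᵢ/qᵢ − m/p| ≤ p/qᵢ < ε  as soon as  p · (denominator of ε) ≤ i
  converges : ConvergesTo (λ i → frac (Cᵢ.h i) (prime i) (isPrime i)) (frac m p pp)
  converges ε ε>0 = p * ℚ.↧ₙ ε , λ i N≤i →
    approximation pp (isPrime i) m (Cᵢ.h i) ε ε>0 (Cᵢ.h-lower i) (Cᵢ.h-upper i)
      (≤-<-trans N≤i (≤-<-trans (m≤n+m i p) (above i)))
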